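{- Let $G$ be a finite simple graph and $r\ge1$ an integer. If $\iota_r(G)>\frac{\omega(G)}{2}$, then $\chi_r(G)-M_r(G)\le\frac{\omega(G)+\Delta(G)+1}{2}$.
   Context: An $r$-bounded coloring of $G$ is a proper coloring in which every color class has at most $r$ vertices. $\chi_r(G)$ is the minimum number of color classes in an $r$-bounded coloring of $G$; an $r$-bounded coloring with $\chi_r(G)$ classes is an optimal $r$-bounded coloring. $M_r(G)$ is the maximum, over all optimal $r$-bounded colorings, of the number of color classes of size exactly $r$. $\iota_r(G)$ (the $r$-bounded stinginess) is the maximum number of singleton color classes in an optimal $r$-bounded coloring of $G$. $\omega(G)$, $\Delta(G)$ are the clique number and maximum degree. -}

module Defs where

open import Data.Nat using (ℕ; _≤_; _⊔_)
open import Data.Fin using (Fin)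
open import Data.Fin.Properties using (_≟_)
open import Data.Fin.Subset using (Subset; _∈_; ∣_∣)
open import Data.Bool using (Bool; T)
open import Data.List using (List; length; filter; map; foldr; allFin)
open import Data.Nat.Properties using () renaming (_≟_ to _≟ℕ_)
open import Data.Product using (Σ; _×_; ∃)
open import Relation.Binary.PropositionalEquality using (_≡_; _≢_)
open import Relation.Nullary using (¬_)

record Graph (n : ℕ) : Set where
  field
    adj   : Fin n → Fin n → Bool
    sym   : ∀ u v → adj u v ≡ adj v u
    irref : ∀ v → adj v v ≡ Bool.false
open Graph public

Adj : ∀ {n} → Graph n → Fin n → Fin n → Set
Adj G u v = T (adj G u v)

degree : ∀ {n} → Graph n → Fin n → ℕ
degree {n} G v = length (filter (λ u → T? (adj G v u)) (allFin n))
  where open import Data.Bool.Properties using (T?)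

Δ : ∀ {n} → Graph n → ℕ
Δ {n} G = foldr _⊔_ 0 (map (degree G) (allFin n))

IsClique : ∀ {n} → Graph n → Subset n → Set
IsClique G S = ∀ u v → u ∈ S → v ∈ S → u ≢ v → Adj G u v

IsCliqueNumber : ∀ {n} → Graph n → ℕ → Set
IsCliqueNumber {n} G w =
  (Σ (Subset n) λ S → IsClique G S × ∣ S ∣ ≡ w) ×
  (∀ (S : Subset n) → IsClique G S → ∣ S ∣ ≤ w)

Proper : ∀ {n k} → Graph n → (Fin n → Fin k) → Set
Proper G c = ∀ u v → Adj G u v → c u ≢ c v

classSize : ∀ {n k} → (Fin n → Fin k) → Fin k → ℕ
classSize {n} c i = length (filter (λ v → c v ≟ i) (allFin n))

Bounded : ∀ {n k} → ℕ → (Fin n → Fin k) → Set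
Bounded r c = ∀ i → classSize c i ≤ r

RBounded : ∀ {n k} → ℕ → Graph n → (Fin n → Fin k) → Set
RBounded r G c = Proper G c × Bounded r c

-- χ_r(G) = k : the least k admitting an r-bounded coloring with k colors.
-- (In an optimal coloring every color is used, so k = number of color classes.)
IsChiR : ∀ {n} → ℕ → Graph n → ℕ → Set
IsChiR {n} r G k =
  (Σ (Fin n → Fin k) λ c → RBounded r G c) ×
  (∀ k' (c : Fin n → Fin k') → RBounded r G c → k ≤ k')

classesOfSize : ∀ {n k} → ℕ → (Fin n → Fin k) → ℕ
classesOfSize {k = k} s c = length (filter (λ i → classSize c i ≟ℕ s) (allFin k))

Optimal : ∀ {n} → ℕ → Graph n → (k : ℕ) → (Fin n → Fin k) → Set
Optimal r G k c = IsChiR r G k × RBounded r G c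

IsMR : ∀ {n} → ℕ → Graph n → ℕ → Set
IsMR {n} r G m =
  (Σ ℕ λ k → Σ (Fin n → Fin k) λ c → Optimal r G k c × classesOfSize r c ≡ m) ×
  (∀ k (c : Fin n → Fin k) → Optimal r G k c → classesOfSize r c ≤ m)

IsIotaR : ∀ {n} → ℕ → Graph n → ℕ → Set
IsIotaR {n} r G t =
  (Σ ℕ λ k → Σ (Fin n → Fin k) λ c → Optimal r G k c × classesOfSize 1 c ≡ t) ×
  (∀ k (c : Fin n → Fin k) → Optimal r G k c → classesOfSize 1 c ≤ t)

-- Fix an optimal r-bounded colouring with ι_r singleton classes, s of them, and call a class medium
-- if its size lies strictly between 1 and r; let m be the number of medium classes.  For r ≤ 1 every
-- class is full; otherwise χ_r − M_r ≤ s + m.  Optimality forbids recolouring a singleton vertex v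
-- into a non-full class containing none of its neighbours, so v is adjacent to every other singleton
-- and to every medium class, and s + 2m ≤ deg v + J(v) + 1, where J(v) counts the medium classes
-- holding exactly one neighbour of v.  Swapping v with such a sole neighbour w gives another optimal
-- colouring in which w is a singleton; hence sole neighbours are adjacent to all singletons, and sole
-- neighbours of two distinct singletons lying in distinct classes are adjacent.  If every singleton
-- owned a medium class (one in which no other singleton has a sole neighbour), the singletons and
-- their owned sole neighbours would form a clique of size 2s > ω.  So some singleton v shares all its
-- sole-neighbour classes, and then the singletons together with the sole neighbours of v form a
-- clique: s + J(v) ≤ ω.  Adding the two inequalities gives 2(s + m) ≤ ω + Δ + 1.

module Submission where

open import Defs renaming (sym to adj-sym)
open import Data.Nat using (ℕ; zero; suc; z≤n; s≤s; _≤_; _<_; _+_; _*_; _∸_; _⊔_; _≤?_; _<?_)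
open import Data.Nat.Properties
  using (≤-refl; ≤-trans; ≤-antisym; ≤-reflexive; <-irrefl; <⇒≱; ≤∧≢⇒<; ≰⇒>; ≤-pred; m≤m+n; m≤n+m; m≤m⊔n; m≤n⊔m;
         +-comm; +-identityʳ; +-mono-≤; +-monoˡ-≤; +-monoʳ-≤; *-monoʳ-≤; ∸-mono; m≤n+o⇒m∸n≤o; m≤n⇒m∸n≡0;
         +-0-commutativeMonoid; module ≤-Reasoning)
  renaming (_≟_ to _≟ℕ_)
open import Data.Fin using (Fin; punchIn; punchOut) renaming (zero to fzero; suc to fsuc)
open import Data.Fin.Properties using (_≟_; suc-injective; any?; all?; punchOut-injective; punchIn-punchOut; ¬∀⟶∃¬)
open import Data.Bool using (Bool; true; false; T; _∧_; _∨_; not)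
open import Data.Bool.Properties using (T?; T-∧; T-∨)
open import Data.List using (length; filter; map; foldr; tabulate)
open import Data.Fin.Permutation using (Permutation′; transpose; _⟨$⟩ʳ_)
open import Data.Fin.Subset using (_∈_; ∣_∣)
import Data.Vec as V
open import Data.Vec.Functional using (updateAt)
open import Data.Vec.Functional.Properties using (updateAt-updates; updateAt-minimal)
open import Data.Vec.Properties using ([]=⇒lookup; lookup∘tabulate)
open import Data.Product using (_×_; ∃; _,_; proj₁; proj₂)
open import Data.Sum using (_⊎_; inj₁; inj₂; [_,_])
open import Data.Empty using (⊥-elim)
open import Data.Unit using (tt)
open import Function using (_∘_; id; const; case_of_; Equivalence; Injection)
open import Function.Properties.Inverse using (↔⇒↣)
open import Relation.Binary.PropositionalEquality
  using (_≡_; _≢_; refl; sym; trans; cong; cong₂; subst; subst₂; module ≡-Reasoning)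
open import Relation.Nullary using (¬_; ¬?; Dec; yes; no; does; contradiction; _×-dec_; _→-dec_)
open import Data.Nat.Tactic.RingSolver using (solve-∀)
open import Algebra.Properties.CommutativeMonoid.Sum +-0-commutativeMonoid using (sum; sum-cong-≗; ∑-distrib-+; ∑-comm)

private variable
  n k : ℕ

does⁺ : ∀ {p} {P : Set p} (P? : Dec P) → P → T (does P?)
does⁺ (yes _) _ = tt
does⁺ (no ¬p) p = ¬p p

does⁻ : ∀ {p} {P : Set p} (P? : Dec P) → T (does P?) → P
does⁻ (yes p) _ = p

∧⁺ : ∀ {a b} → T a → T b → T (a ∧ b)
∧⁺ x y = Equivalence.from T-∧ (x , y)

∧⁻ˡ : ∀ {a b} → T (a ∧ b) → T a
∧⁻ˡ = proj₁ ∘ Equivalence.to T-∧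

∧⁻ʳ : ∀ {a b} → T (a ∧ b) → T b
∧⁻ʳ {a} = proj₂ ∘ Equivalence.to (T-∧ {a})

∨⁻ : ∀ {a b} → T (a ∨ b) → T a ⊎ T b
∨⁻ = Equivalence.to T-∨

∨⁺ : ∀ {a b} → T a ⊎ T b → T (a ∨ b)
∨⁺ = Equivalence.from T-∨

not⁺ : ∀ {a} → ¬ T a → T (not a)
not⁺ {true} ¬a = ¬a tt
not⁺ {false} _ = tt

not⁻ : ∀ {a} → T (not a) → ¬ T a
not⁻ {false} _ ()

𝟙 : Bool → ℕ
𝟙 true = 1
𝟙 false = 0

count : (Fin n → Bool) → ℕ
count f = sum (𝟙 ∘ f)

is : Fin n → Fin n → Bool
is a i = does (i ≟ a)

sum-mono-≤ : (f g : Fin k → ℕ) → (∀ j → f j ≤ g j) → sum f ≤ sum g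
sum-mono-≤ {zero} f g f≤g = z≤n
sum-mono-≤ {suc k} f g f≤g = +-mono-≤ (f≤g fzero) (sum-mono-≤ (f ∘ fsuc) (g ∘ fsuc) (f≤g ∘ fsuc))

length-filter-tabulate : ∀ {a p} {A : Set a} {P : A → Set p} (P? : ∀ x → Dec (P x)) (g : Fin n → A) →
  length (filter P? (tabulate g)) ≡ count (λ i → does (P? (g i)))
length-filter-tabulate {zero} P? g = refl
length-filter-tabulate {suc n} P? g with does (P? (g fzero))
... | true = cong suc (length-filter-tabulate P? (g ∘ fsuc))
... | false = length-filter-tabulate P? (g ∘ fsuc)

𝟙-mono : ∀ {a b} → (T a → T b) → 𝟙 a ≤ 𝟙 b
𝟙-mono {false} _ = z≤n
𝟙-mono {true} {true} _ = ≤-refl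
𝟙-mono {true} {false} a⇒b = ⊥-elim (a⇒b tt)

count-mono : (f g : Fin n → Bool) → (∀ i → T (f i) → T (g i)) → count f ≤ count g
count-mono f g f⊆g = sum-mono-≤ (𝟙 ∘ f) (𝟙 ∘ g) (λ i → 𝟙-mono (f⊆g i))

count-none : (f : Fin n → Bool) → (∀ i → ¬ T (f i)) → count f ≡ 0
count-none {zero} f none = refl
count-none {suc n} f none with f fzero in eq
... | true = contradiction (subst T (sym eq) tt) (none fzero)
... | false = count-none (f ∘ fsuc) (none ∘ fsuc)

count-true : ∀ n → count {n} (λ _ → true) ≡ n
count-true zero = refl
count-true (suc n) = cong suc (count-true n)

count-witness : (f : Fin n → Bool) → 1 ≤ count f → ∃ λ i → T (f i)
count-witness {suc n} f pos with f fzero in eq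
... | true = fzero , subst T (sym eq) tt
... | false with count-witness (f ∘ fsuc) pos
...   | i , fi = fsuc i , fi

count-pos : (f : Fin n → Bool) (i : Fin n) → T (f i) → 1 ≤ count f
count-pos f fzero fi with f fzero
... | true = s≤s z≤n
count-pos {suc n} f (fsuc i) fi = ≤-trans (count-pos (f ∘ fsuc) i fi) (m≤n+m _ _)

count-is : (a : Fin n) → count (is a) ≡ 1
count-is {suc n} fzero = cong suc (count-none {n} (is fzero ∘ fsuc) λ i ())
count-is {suc n} (fsuc a) = count-is a

count-is-flip : (a : Fin n) → count (λ i → does (a ≟ i)) ≡ 1
count-is-flip {suc n} fzero = cong suc (count-none {n} (λ i → does (fzero ≟ fsuc i)) λ i ())
count-is-flip {suc n} (fsuc a) = count-is-flip a

𝟙-∨-∧ : ∀ a b → 𝟙 (a ∨ b) + 𝟙 (a ∧ b) ≡ 𝟙 a + 𝟙 b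
𝟙-∨-∧ false b = +-identityʳ (𝟙 b)
𝟙-∨-∧ true false = refl
𝟙-∨-∧ true true = refl

count-∨-∧ : (f g : Fin n → Bool) → count (λ i → f i ∨ g i) + count (λ i → f i ∧ g i) ≡ count f + count g
count-∨-∧ f g = begin
  count (λ i → f i ∨ g i) + count (λ i → f i ∧ g i) ≡⟨ ∑-distrib-+ (λ i → 𝟙 (f i ∨ g i)) (λ i → 𝟙 (f i ∧ g i)) ⟨
  sum (λ i → 𝟙 (f i ∨ g i) + 𝟙 (f i ∧ g i))         ≡⟨ sum-cong-≗ (λ i → 𝟙-∨-∧ (f i) (g i)) ⟩
  sum (λ i → 𝟙 (f i) + 𝟙 (g i))                     ≡⟨ ∑-distrib-+ (𝟙 ∘ f) (𝟙 ∘ g) ⟩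
  count f + count g                                 ∎
  where open ≡-Reasoning

count-cover : (f g h : Fin n → Bool) → (∀ i → T (f i) → T (g i) ⊎ T (h i)) → count f ≤ count g + count h
count-cover f g h cover = begin
  count f                                           ≤⟨ count-mono f (λ i → g i ∨ h i) (λ i → ∨⁺ ∘ cover i) ⟩
  count (λ i → g i ∨ h i)                           ≤⟨ m≤m+n _ _ ⟩
  count (λ i → g i ∨ h i) + count (λ i → g i ∧ h i) ≡⟨ count-∨-∧ g h ⟩
  count g + count h                                 ∎
  where open ≤-Reasoning

count-disjoint : (f g : Fin n → Bool) → (∀ i → T (f i) → ¬ T (g i)) → count f + count g ≤ count (λ i → f i ∨ g i)
count-disjoint f g disjoint = begin
  count f + count g                                 ≡⟨ count-∨-∧ f g ⟨
  count (λ i → f i ∨ g i) + count (λ i → f i ∧ g i) ≡⟨ cong (count (λ i → f i ∨ g i) +_) none-in-both ⟩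
  count (λ i → f i ∨ g i) + 0                       ≡⟨ +-identityʳ _ ⟩
  count (λ i → f i ∨ g i)                           ∎
  where
  open ≤-Reasoning
  none-in-both : count (λ i → f i ∧ g i) ≡ 0
  none-in-both = count-none (λ i → f i ∧ g i) λ i fg → disjoint i (∧⁻ˡ fg) (∧⁻ʳ fg)

count-remove : (f : Fin n → Bool) (a : Fin n) → T (f a) → count (λ i → f i ∧ not (is a i)) + 1 ≤ count f
count-remove f a fa = begin
  count f′ + 1               ≡⟨ cong (count f′ +_) (count-is a) ⟨
  count f′ + count (is a)    ≤⟨ count-disjoint f′ (is a) (λ i f′i → not⁻ (∧⁻ʳ f′i)) ⟩
  count (λ i → f′ i ∨ is a i) ≤⟨ count-mono _ f (λ i → [ ∧⁻ˡ {f i} , at-a i ] ∘ ∨⁻) ⟩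
  count f                    ∎
  where
  open ≤-Reasoning
  f′ : Fin _ → Bool
  f′ i = f i ∧ not (is a i)
  at-a : ∀ i → T (is a i) → T (f i)
  at-a i i≡a = subst (T ∘ f) (sym (does⁻ (i ≟ a) i≡a)) fa

count≤1⇒unique : (f : Fin n → Bool) → count f ≤ 1 → ∀ a b → T (f a) → T (f b) → a ≡ b
count≤1⇒unique f count≤1 a b fa fb with a ≟ b
... | yes a≡b = a≡b
... | no a≢b = contradiction (≤-trans two≤count count≤1) λ { (s≤s ()) }
  where
  f-a : Fin _ → Bool
  f-a i = f i ∧ not (is a i)
  two≤count : 2 ≤ count f
  two≤count = ≤-trans (+-monoˡ-≤ 1 (count-pos f-a b (∧⁺ fb (not⁺ (a≢b ∘ sym ∘ does⁻ (b ≟ a))))))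
                      (count-remove f a fa)

count-injection : ∀ {m} (f : Fin n → Bool) (g : Fin m → Bool) (φ : Fin n → Fin m) →
  (∀ i → T (f i) → T (g (φ i))) → (∀ i j → T (f i) → T (f j) → φ i ≡ φ j → i ≡ j) → count f ≤ count g
count-injection {zero} f g φ maps inj = z≤n
count-injection {suc n} f g φ maps inj with f fzero in eq
... | false = count-injection (f ∘ fsuc) g (φ ∘ fsuc) (maps ∘ fsuc) inj-tail
  where
  inj-tail : ∀ i j → T (f (fsuc i)) → T (f (fsuc j)) → φ (fsuc i) ≡ φ (fsuc j) → i ≡ j
  inj-tail i j fi fj = suc-injective ∘ inj _ _ fi fj
... | true = begin
  1 + count (f ∘ fsuc) ≡⟨ +-comm 1 _ ⟩
  count (f ∘ fsuc) + 1 ≤⟨ +-monoˡ-≤ 1 (count-injection (f ∘ fsuc) g′ (φ ∘ fsuc) maps′ inj-tail) ⟩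
  count g′ + 1         ≤⟨ count-remove g (φ fzero) (maps fzero f₀) ⟩
  count g              ∎
  where
  open ≤-Reasoning
  inj-tail : ∀ i j → T (f (fsuc i)) → T (f (fsuc j)) → φ (fsuc i) ≡ φ (fsuc j) → i ≡ j
  inj-tail i j fi fj = suc-injective ∘ inj _ _ fi fj
  f₀ : T (f fzero)
  f₀ = subst T (sym eq) tt
  g′ : Fin _ → Bool
  g′ i = g i ∧ not (is (φ fzero) i)
  maps′ : ∀ i → T (f (fsuc i)) → T (g′ (φ (fsuc i)))
  maps′ i fi = ∧⁺ (maps (fsuc i) fi) (not⁺ λ hit → case inj _ _ fi f₀ (does⁻ (φ (fsuc i) ≟ φ fzero) hit) of λ ())

count-partition : (c : Fin n → Fin k) (f : Fin n → Bool) → count f ≡ sum (λ j → count (λ z → f z ∧ is j (c z)))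
count-partition {k = k} c f = begin
  count f                                            ≡⟨ sum-cong-≗ count-colours ⟨
  sum (λ z → sum (λ j → 𝟙 (f z ∧ is j (c z))))       ≡⟨ ∑-comm (λ z j → 𝟙 (f z ∧ is j (c z))) ⟩
  sum (λ j → count (λ z → f z ∧ is j (c z)))         ∎
  where
  open ≡-Reasoning
  count-colours : ∀ z → count (λ j → f z ∧ is j (c z)) ≡ 𝟙 (f z)
  count-colours z with f z
  ... | true = count-is-flip (c z)
  ... | false = count-none {k} (λ _ → false) (λ _ ())

∣tabulate∣≡count : (b : Fin n → Bool) → ∣ V.tabulate b ∣ ≡ count b
∣tabulate∣≡count {zero} b = refl
∣tabulate∣≡count {suc n} b with b fzero
... | true = cong suc (∣tabulate∣≡count (b ∘ fsuc))
... | false = ∣tabulate∣≡count (b ∘ fsuc)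

∈-tabulate⁻ : (b : Fin n → Bool) (x : Fin n) → x ∈ V.tabulate b → T (b x)
∈-tabulate⁻ b x x∈b = subst T (trans (sym ([]=⇒lookup x∈b)) (lookup∘tabulate b x)) tt

classSize≡count : (c : Fin n → Fin k) (i : Fin k) → classSize c i ≡ count (λ v → is i (c v))
classSize≡count c i = length-filter-tabulate (λ v → c v ≟ i) id

classesOfSize≡count : (s : ℕ) (c : Fin n → Fin k) →
  classesOfSize s c ≡ count (λ i → does (classSize c i ≟ℕ s))
classesOfSize≡count s c = length-filter-tabulate (λ i → classSize c i ≟ℕ s) id

module _ (G : Graph n) where

  degree≡count : (v : Fin n) → degree G v ≡ count (adj G v)
  degree≡count v = length-filter-tabulate (λ u → T? (adj G v u)) id

  degree≤Δ : (v : Fin n) → degree G v ≤ Δ G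
  degree≤Δ = foldr-⊔-tabulate (degree G) id
    where
    foldr-⊔-tabulate : ∀ {m} (g : Fin n → ℕ) (h : Fin m → Fin n) i →
      g (h i) ≤ foldr _⊔_ 0 (map g (tabulate h))
    foldr-⊔-tabulate g h fzero = m≤m⊔n _ _
    foldr-⊔-tabulate g h (fsuc i) = ≤-trans (foldr-⊔-tabulate g (h ∘ fsuc) i) (m≤n⊔m (g (h fzero)) _)

  clique-count≤ω : ∀ {ω} → IsCliqueNumber G ω → (b : Fin n → Bool) →
    (∀ u w → T (b u) → T (b w) → u ≢ w → Adj G u w) → count b ≤ ω
  clique-count≤ω (_ , maximal) b clique = subst (_≤ _) (∣tabulate∣≡count b)
    (maximal (V.tabulate b) λ u w u∈b w∈b → clique u w (∈-tabulate⁻ b u u∈b) (∈-tabulate⁻ b w w∈b))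

  Adj-irrefl : (x : Fin n) → ¬ Adj G x x
  Adj-irrefl x = subst T (irref G x)

  Adj-sym : {x y : Fin n} → Adj G x y → Adj G y x
  Adj-sym {x} {y} = subst T (adj-sym G x y)

Singleton : (Fin n → Fin k) → Fin n → Set
Singleton c v = ∀ x → c x ≡ c v → x ≡ v

classSize-mono : ∀ {k′} (c : Fin n → Fin k) (c′ : Fin n → Fin k′) (i : Fin k) (i′ : Fin k′) →
  (∀ x → c′ x ≡ i′ → c x ≡ i) → classSize c′ i′ ≤ classSize c i
classSize-mono c c′ i i′ ⊆ = subst₂ _≤_ (sym (classSize≡count c′ i′)) (sym (classSize≡count c i))
  (count-mono _ _ λ x x∈i′ → does⁺ (c x ≟ i) (⊆ x (does⁻ (c′ x ≟ i′) x∈i′)))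

classSize≥1 : (c : Fin n → Fin k) (v : Fin n) → 1 ≤ classSize c (c v)
classSize≥1 c v = subst (1 ≤_) (sym (classSize≡count c (c v))) (count-pos _ v (does⁺ (c v ≟ c v) refl))

classSize-member : (c : Fin n → Fin k) (i : Fin k) → 1 ≤ classSize c i → ∃ λ v → c v ≡ i
classSize-member c i pos with count-witness _ (subst (1 ≤_) (classSize≡count c i) pos)
... | v , v∈i = v , does⁻ (c v ≟ i) v∈i

Singleton⇒classSize≤1 : (c : Fin n → Fin k) (v : Fin n) → Singleton c v → classSize c (c v) ≤ 1
Singleton⇒classSize≤1 c v single = subst (_≤ 1) (sym (classSize≡count c (c v)))
  (≤-trans (count-mono _ (is v) λ x x∈cv → does⁺ (x ≟ v) (single x (does⁻ (c x ≟ c v) x∈cv)))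
           (≤-reflexive (count-is v)))

classSize-permute : (c : Fin n → Fin k) (π : Permutation′ n) (i : Fin k) →
  classSize (c ∘ (π ⟨$⟩ʳ_)) i ≤ classSize c i
classSize-permute c π i = subst₂ _≤_ (sym (classSize≡count (c ∘ (π ⟨$⟩ʳ_)) i)) (sym (classSize≡count c i))
  (count-injection _ _ (π ⟨$⟩ʳ_) (λ _ → id) λ _ _ _ _ → Injection.injective (↔⇒↣ π))

Singleton-permute : (c : Fin n → Fin k) (π : Permutation′ n) (u : Fin n) →
  Singleton c (π ⟨$⟩ʳ u) → Singleton (c ∘ (π ⟨$⟩ʳ_)) u
Singleton-permute c π u single x = Injection.injective (↔⇒↣ π) ∘ single (π ⟨$⟩ʳ x)

data Transposition (v w : Fin n) : Fin n → Fin n → Set where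
  at-first : Transposition v w v w
  at-second : Transposition v w w v
  elsewhere : ∀ {x} → x ≢ v → x ≢ w → Transposition v w x x

transposition : (v w x : Fin n) → Transposition v w x (transpose v w ⟨$⟩ʳ x)
transposition v w x with x ≟ v
... | yes refl = at-first
... | no x≢v with x ≟ w
...   | yes refl = at-second
...   | no x≢w = elsewhere x≢v x≢w

transpose-second : (v w : Fin n) → transpose v w ⟨$⟩ʳ w ≡ v
transpose-second v w with transpose v w ⟨$⟩ʳ w | transposition v w w
... | _ | at-first = refl
... | _ | at-second = refl
... | _ | elsewhere _ w≢w = contradiction refl w≢w

transpose-elsewhere : {v w x : Fin n} → x ≢ v → x ≢ w → transpose v w ⟨$⟩ʳ x ≡ x
transpose-elsewhere {v = v} {w} {x} x≢v x≢w with transpose v w ⟨$⟩ʳ x | transposition v w x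
... | _ | at-first = contradiction refl x≢v
... | _ | at-second = contradiction refl x≢w
... | _ | elsewhere _ _ = refl

module Recolouring (G : Graph n) (r : ℕ) where

  SoleNeighbour : (Fin n → Fin k) → Fin n → Fin n → Set
  SoleNeighbour c v w = ∀ z → c z ≡ c w → Adj G v z → z ≡ w

  optimal-colour-used : IsChiR r G k → (c : Fin n → Fin k) → RBounded r G c → (i : Fin k) →
    ¬ (∀ v → c v ≢ i)
  optimal-colour-used {suc k} (_ , minimal) c (proper , bounded) i unused =
    contradiction (minimal k c′ (proper′ , bounded′)) (<-irrefl refl)
    where
    c′ : Fin n → Fin k
    c′ v = punchOut (unused v ∘ sym)
    proper′ : Proper G c′
    proper′ u v u~v = proper u v u~v ∘ punchOut-injective (unused u ∘ sym) (unused v ∘ sym)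
    bounded′ : Bounded r c′
    bounded′ j = ≤-trans (classSize-mono c c′ (punchIn i j) j λ x c′x≡j →
      trans (sym (punchIn-punchOut (unused x ∘ sym))) (cong (punchIn i) c′x≡j)) (bounded (punchIn i j))

  optimal-classSize≥1 : IsChiR r G k → (c : Fin n → Fin k) → RBounded r G c → (j : Fin k) →
    1 ≤ classSize c j
  optimal-classSize≥1 chi c rb j with 1 ≤? classSize c j
  ... | yes pos = pos
  ... | no empty = contradiction (λ v cv≡j → empty (subst (λ i → 1 ≤ classSize c i) cv≡j (classSize≥1 c v)))
                                 (optimal-colour-used chi c rb j)

  r≤1⇒optimal-classes-full : r ≤ 1 → IsChiR r G k → (c : Fin n → Fin k) → RBounded r G c →
    k ≤ classesOfSize r c
  r≤1⇒optimal-classes-full {k} r≤1 chi c rb = begin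
    k                                           ≡⟨ count-true k ⟨
    count {k} (λ _ → true)                      ≤⟨ count-mono _ _ (λ j _ → does⁺ (classSize c j ≟ℕ r) (full j)) ⟩
    count (λ j → does (classSize c j ≟ℕ r))     ≡⟨ classesOfSize≡count r c ⟨
    classesOfSize r c                           ∎
    where
    open ≤-Reasoning
    full : ∀ j → classSize c j ≡ r
    full j = ≤-antisym (proj₂ rb j) (≤-trans r≤1 (optimal-classSize≥1 chi c rb j))

  private
    recolour-cases : (c : Fin n → Fin k) (v : Fin n) (i : Fin k) (x : Fin n) →
      (x ≡ v × updateAt c v (const i) x ≡ i) ⊎ (x ≢ v × updateAt c v (const i) x ≡ c x)
    recolour-cases c v i x with x ≟ v
    ... | yes refl = inj₁ (refl , updateAt-updates v c)
    ... | no x≢v = inj₂ (x≢v , updateAt-minimal x v c x≢v)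

  recolour-rbounded : (c : Fin n → Fin k) → RBounded r G c → (v : Fin n) (i : Fin k) → classSize c i < r →
    (∀ z → c z ≡ i → ¬ Adj G v z) → RBounded r G (updateAt c v (const i))
  recolour-rbounded c (proper , bounded) v i i-small avoids = proper′ , bounded′
    where
    c′ : Fin n → Fin _
    c′ = updateAt c v (const i)
    proper′ : Proper G c′
    proper′ x y x~y c′x≡c′y with recolour-cases c v i x | recolour-cases c v i y
    ... | inj₁ (refl , ex) | inj₁ (refl , ey) = Adj-irrefl G x x~y
    ... | inj₁ (refl , ex) | inj₂ (_ , ey) = avoids y (trans (sym ey) (trans (sym c′x≡c′y) ex)) x~y
    ... | inj₂ (_ , ex) | inj₁ (refl , ey) = avoids x (trans (sym ex) (trans c′x≡c′y ey)) (Adj-sym G x~y)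
    ... | inj₂ (_ , ex) | inj₂ (_ , ey) = proper x y x~y (trans (sym ex) (trans c′x≡c′y ey))
    class-i : ∀ x → T (is i (c′ x)) → T (is i (c x)) ⊎ T (is v x)
    class-i x x∈i with recolour-cases c v i x
    ... | inj₁ (x≡v , _) = inj₂ (does⁺ (x ≟ v) x≡v)
    ... | inj₂ (_ , ex) = inj₁ (does⁺ (c x ≟ i) (trans (sym ex) (does⁻ (c′ x ≟ i) x∈i)))
    bounded′ : Bounded r c′
    bounded′ j with j ≟ i
    ... | yes refl = subst (_≤ r) (sym (classSize≡count c′ i)) (begin
      count (λ x → is i (c′ x))              ≤⟨ count-cover _ _ (is v) class-i ⟩
      count (λ x → is i (c x)) + count (is v) ≡⟨ cong₂ _+_ (classSize≡count c i) (sym (count-is v)) ⟨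
      classSize c i + 1                      ≡⟨ +-comm _ 1 ⟩
      suc (classSize c i)                    ≤⟨ i-small ⟩
      r                                      ∎)
      where open ≤-Reasoning
    ... | no j≢i = ≤-trans (classSize-mono c c′ j j unchanged) (bounded j)
      where
      unchanged : ∀ x → c′ x ≡ j → c x ≡ j
      unchanged x c′x≡j with recolour-cases c v i x
      ... | inj₁ (_ , ex) = contradiction (trans (sym c′x≡j) ex) j≢i
      ... | inj₂ (_ , ex) = trans (sym ex) c′x≡j

  singleton-adjacent-to-nonfull : IsChiR r G k → (c : Fin n → Fin k) → RBounded r G c → (v : Fin n) →
    Singleton c v → (i : Fin k) → i ≢ c v → classSize c i < r → ∃ λ z → c z ≡ i × Adj G v z
  singleton-adjacent-to-nonfull chi c rb v single i i≢cv i-small with any? (λ z → (c z ≟ i) ×-dec T? (adj G v z))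
  ... | yes adjacent = adjacent
  ... | no avoids = contradiction empty
    (optimal-colour-used chi c′ (recolour-rbounded c rb v i i-small λ z cz≡i v~z → avoids (z , cz≡i , v~z)) (c v))
    where
    c′ : Fin n → Fin _
    c′ = updateAt c v (const i)
    empty : ∀ x → c′ x ≢ c v
    empty x c′x≡cv with recolour-cases c v i x
    ... | inj₁ (_ , ex) = i≢cv (trans (sym ex) c′x≡cv)
    ... | inj₂ (x≢v , ex) = x≢v (single x (trans (sym ex) c′x≡cv))

  swap-rbounded : (c : Fin n → Fin k) → RBounded r G c → {v w : Fin n} →
    Singleton c v → c w ≢ c v → SoleNeighbour c v w → RBounded r G (c ∘ (transpose v w ⟨$⟩ʳ_))
  swap-rbounded c (proper , bounded) {v} {w} single cw≢cv sole =
    proper′ , λ i → ≤-trans (classSize-permute c (transpose v w) i) (bounded i)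
    where
    proper′ : Proper G (c ∘ (transpose v w ⟨$⟩ʳ_))
    proper′ x y x~y e
      with transpose v w ⟨$⟩ʳ x | transposition v w x | transpose v w ⟨$⟩ʳ y | transposition v w y
    ... | _ | at-first | _ | at-first = Adj-irrefl G x x~y
    ... | _ | at-first | _ | at-second = cw≢cv e
    ... | _ | at-first | _ | elsewhere y≢v y≢w = y≢w (sole y (sym e) x~y)
    ... | _ | at-second | _ | at-first = cw≢cv (sym e)
    ... | _ | at-second | _ | at-second = Adj-irrefl G x x~y
    ... | _ | at-second | _ | elsewhere y≢v y≢w = y≢v (single y (sym e))
    ... | _ | elsewhere x≢v x≢w | _ | at-first = x≢w (sole x e (Adj-sym G x~y))
    ... | _ | elsewhere x≢v x≢w | _ | at-second = x≢v (single x e)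
    ... | _ | elsewhere _ _ | _ | elsewhere _ _ = proper x y x~y e

module OptimalAdjacency (G : Graph n) (r : ℕ) (2≤r : 2 ≤ r) (chi : IsChiR r G k) where
  open Recolouring G r

  singletons-adjacent : (c : Fin n → Fin k) → RBounded r G c → {a b : Fin n} →
    Singleton c a → Singleton c b → a ≢ b → Adj G a b
  singletons-adjacent c rb {a} {b} single-a single-b a≢b
    with singleton-adjacent-to-nonfull chi c rb a single-a (c b) (a≢b ∘ single-b a ∘ sym)
           (≤-trans (s≤s (Singleton⇒classSize≤1 c b single-b)) 2≤r)
  ... | z , cz≡cb , a~z = subst (Adj G a) (single-b z cz≡cb) a~z

  sole-neighbour-adjacent : (c : Fin n → Fin k) → RBounded r G c → {v w u : Fin n} →
    Singleton c v → c w ≢ c v → SoleNeighbour c v w → Singleton c u → u ≢ v → c u ≢ c w → Adj G w u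
  sole-neighbour-adjacent c rb {v} {w} {u} single-v cw≢cv sole single-u u≢v cu≢cw =
    singletons-adjacent c′ (swap-rbounded c rb single-v cw≢cv sole) single-w′ single-u′ (cu≢cw ∘ sym ∘ cong c)
    where
    τ = transpose v w
    c′ = c ∘ (τ ⟨$⟩ʳ_)
    single-w′ : Singleton c′ w
    single-w′ = Singleton-permute c τ w (subst (Singleton c) (sym (transpose-second v w)) single-v)
    single-u′ : Singleton c′ u
    single-u′ = Singleton-permute c τ u
      (subst (Singleton c) (sym (transpose-elsewhere u≢v (cu≢cw ∘ cong c))) single-u)

  sole-neighbours-adjacent : (c : Fin n → Fin k) → RBounded r G c → {x y wx wy : Fin n} →
    Singleton c x → Singleton c y → x ≢ y → SoleNeighbour c x wx → SoleNeighbour c y wy →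
    c wx ≢ c wy → c wx ≢ c x → c wx ≢ c y → c wy ≢ c x → c wy ≢ c y → Adj G wx wy
  sole-neighbours-adjacent c rb {x} {y} {wx} {wy} single-x single-y x≢y sole-x sole-y
                           cwx≢cwy cwx≢cx cwx≢cy cwy≢cx cwy≢cy =
    Adj-sym G (sole-neighbour-adjacent c′ (swap-rbounded c rb single-x cwx≢cx sole-x)
      single-y′ c′wy≢c′y sole-y′ single-wx′ (cwx≢cy ∘ cong c) c′wx≢c′wy)
    where
    τ = transpose x wx
    c′ = c ∘ (τ ⟨$⟩ʳ_)
    τy≡y : τ ⟨$⟩ʳ y ≡ y
    τy≡y = transpose-elsewhere (x≢y ∘ sym) (cwx≢cy ∘ cong c ∘ sym)
    c′wy≡cwy : c′ wy ≡ c wy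
    c′wy≡cwy = cong c (transpose-elsewhere (cwy≢cx ∘ cong c) (cwx≢cwy ∘ cong c ∘ sym))
    c′wx≡cx : c′ wx ≡ c x
    c′wx≡cx = cong c (transpose-second x wx)
    single-y′ : Singleton c′ y
    single-y′ = Singleton-permute c τ y (subst (Singleton c) (sym τy≡y) single-y)
    single-wx′ : Singleton c′ wx
    single-wx′ = Singleton-permute c τ wx (subst (Singleton c) (sym (transpose-second x wx)) single-x)
    c′wy≢c′y : c′ wy ≢ c′ y
    c′wy≢c′y e = cwy≢cy (trans (sym c′wy≡cwy) (trans e (cong c τy≡y)))
    c′wx≢c′wy : c′ wx ≢ c′ wy
    c′wx≢c′wy e = cwy≢cx (trans (sym c′wy≡cwy) (trans (sym e) c′wx≡cx))
    sole-y′ : SoleNeighbour c′ y wy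
    sole-y′ z c′z≡c′wy y~z with τ ⟨$⟩ʳ z | transposition x wx z
    ... | _ | at-first = contradiction (trans c′z≡c′wy c′wy≡cwy) cwx≢cwy
    ... | _ | at-second = contradiction (trans c′z≡c′wy c′wy≡cwy) (cwy≢cx ∘ sym)
    ... | _ | elsewhere _ _ = sole-y z (trans c′z≡c′wy c′wy≡cwy) y~z

excess-arithmetic : ∀ {s m d j w D} → s + (m + m) ≤ (d + j) + 1 → s + j ≤ w → d ≤ D →
  2 * (s + m) ≤ w + D + 1
excess-arithmetic {s} {m} {d} {j} {w} {D} degree-bound clique-bound d≤D = begin
  2 * (s + m)       ≡⟨ regroupˡ s m ⟩
  s + (s + (m + m)) ≤⟨ +-monoʳ-≤ s degree-bound ⟩
  s + ((d + j) + 1) ≡⟨ regroupʳ s d j ⟩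
  (s + j) + d + 1   ≤⟨ +-monoˡ-≤ 1 (+-mono-≤ clique-bound d≤D) ⟩
  w + D + 1         ∎
  where
  open ≤-Reasoning
  regroupˡ : ∀ s m → 2 * (s + m) ≡ s + (s + (m + m))
  regroupˡ = solve-∀
  regroupʳ : ∀ s d j → s + ((d + j) + 1) ≡ (s + j) + d + 1
  regroupʳ = solve-∀

module OptimalCounting (G : Graph n) (r : ℕ) (2≤r : 2 ≤ r) (chi : IsChiR r G k)
                       (c : Fin n → Fin k) (rb : RBounded r G c) where
  open Recolouring G r
  open OptimalAdjacency G r 2≤r chi

  size : Fin k → ℕ
  size = classSize c

  single full medium : Fin k → Bool
  single j = does (size j ≟ℕ 1)
  full j = does (size j ≟ℕ r)
  medium j = does (2 ≤? size j) ∧ does (size j <? r)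

  lone : Fin n → Bool
  lone v = single (c v)

  neighboursIn : Fin n → Fin k → ℕ
  neighboursIn v j = count (λ z → adj G v z ∧ is j (c z))

  soleIn : Fin n → Fin k → Bool
  soleIn v j = medium j ∧ does (neighboursIn v j ≟ℕ 1)

  member : (j : Fin k) → ∃ λ u → c u ≡ j
  member j = classSize-member c j (optimal-classSize≥1 chi c rb j)

  lone-member : (j : Fin k) → T (single j) → ∃ λ u → c u ≡ j × T (lone u)
  lone-member j single-j with member j
  ... | u , refl = u , refl , single-j

  lone⇒Singleton : (v : Fin n) → T (lone v) → Singleton c v
  lone⇒Singleton v lone-v x cx≡cv = count≤1⇒unique (λ z → is (c v) (c z))
    (subst (_≤ 1) (classSize≡count c (c v)) (≤-reflexive (does⁻ (size (c v) ≟ℕ 1) lone-v)))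
    x v (does⁺ (c x ≟ c v) cx≡cv) (does⁺ (c v ≟ c v) refl)

  single⇒¬medium : (j : Fin k) → T (single j) → ¬ T (medium j)
  single⇒¬medium j single-j medium-j with does⁻ (size j ≟ℕ 1) single-j | does⁻ (2 ≤? size j) (∧⁻ˡ medium-j)
  ... | size≡1 | 2≤size = contradiction (subst (2 ≤_) size≡1 2≤size) λ { (s≤s ()) }

  soleIn⇒¬lone : {v u : Fin n} → T (soleIn v (c u)) → ¬ T (lone u)
  soleIn⇒¬lone {v} {u} sole lone-u = single⇒¬medium (c u) lone-u (∧⁻ˡ sole)

  soleIn≢lone : {v w u : Fin n} → T (soleIn v (c w)) → T (lone u) → c w ≢ c u
  soleIn≢lone sole lone-u cw≡cu = soleIn⇒¬lone sole (subst (T ∘ single) (sym cw≡cu) lone-u)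

  soleIn-witness : (v : Fin n) (j : Fin k) → T (soleIn v j) → ∃ λ w → c w ≡ j × Adj G v w
  soleIn-witness v j sole with count-witness (λ z → adj G v z ∧ is j (c z))
                                 (≤-reflexive (sym (does⁻ (neighboursIn v j ≟ℕ 1) (∧⁻ʳ {medium j} sole))))
  ... | w , hit = w , does⁻ (c w ≟ j) (∧⁻ʳ {adj G v w} hit) , ∧⁻ˡ hit

  soleIn⇒SoleNeighbour : {v w : Fin n} → T (soleIn v (c w)) → Adj G v w → SoleNeighbour c v w
  soleIn⇒SoleNeighbour {v} {w} sole v~w z cz≡cw v~z = count≤1⇒unique (λ z → adj G v z ∧ is (c w) (c z))
    (≤-reflexive (does⁻ (neighboursIn v (c w) ≟ℕ 1) (∧⁻ʳ {medium (c w)} sole)))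
    z w (∧⁺ v~z (does⁺ (c z ≟ c w) cz≡cw)) (∧⁺ v~w (does⁺ (c w ≟ c w) refl))

  lones-adjacent : {u w : Fin n} → T (lone u) → T (lone w) → u ≢ w → Adj G u w
  lones-adjacent lone-u lone-w = singletons-adjacent c rb (lone⇒Singleton _ lone-u) (lone⇒Singleton _ lone-w)

  sole-neighbour-adjacent-lone : {v w u : Fin n} → T (lone v) → T (soleIn v (c w)) → Adj G v w → T (lone u) →
    Adj G w u
  sole-neighbour-adjacent-lone {v} {w} {u} lone-v sole v~w lone-u with u ≟ v
  ... | yes refl = Adj-sym G v~w
  ... | no u≢v = sole-neighbour-adjacent c rb (lone⇒Singleton v lone-v) (soleIn≢lone sole lone-v)
                   (soleIn⇒SoleNeighbour sole v~w) (lone⇒Singleton u lone-u) u≢v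
                   (soleIn≢lone sole lone-u ∘ sym)

  sole-neighbours-adjacent-lone : {x y a b : Fin n} → T (lone x) → T (lone y) → x ≢ y →
    T (soleIn x (c a)) → Adj G x a → T (soleIn y (c b)) → Adj G y b → c a ≢ c b → Adj G a b
  sole-neighbours-adjacent-lone lone-x lone-y x≢y sole-a x~a sole-b y~b ca≢cb =
    sole-neighbours-adjacent c rb (lone⇒Singleton _ lone-x) (lone⇒Singleton _ lone-y) x≢y
      (soleIn⇒SoleNeighbour sole-a x~a) (soleIn⇒SoleNeighbour sole-b y~b) ca≢cb
      (soleIn≢lone sole-a lone-x) (soleIn≢lone sole-a lone-y)
      (soleIn≢lone sole-b lone-x) (soleIn≢lone sole-b lone-y)

  degree-bound-at : (v : Fin n) → T (lone v) → (j : Fin k) →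
    𝟙 (single j) + (𝟙 (medium j) + 𝟙 (medium j)) ≤ (neighboursIn v j + 𝟙 (soleIn v j)) + 𝟙 (is (c v) j)
  degree-bound-at v lone-v j with j ≟ c v | single j in single-j | medium j in medium-j
  ... | yes refl | true | true = contradiction (subst T (sym medium-j) tt) (single⇒¬medium j lone-v)
  ... | yes refl | false | _ = ⊥-elim (subst T single-j lone-v)
  ... | yes refl | true | false = m≤n+m 1 _
  ... | no _ | true | true =
    contradiction (subst T (sym medium-j) tt) (single⇒¬medium j (subst T (sym single-j) tt))
  ... | no _ | false | false = z≤n
  ... | no j≢cv | true | false with lone-member j (subst T (sym single-j) tt)
  ...   | u , refl , lone-u =
    ≤-trans (count-pos _ u (∧⁺ v~u (does⁺ (c u ≟ c u) refl))) (≤-trans (m≤m+n _ _) (m≤m+n _ _))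
    where
    v~u : Adj G v u
    v~u = lones-adjacent lone-v lone-u (j≢cv ∘ sym ∘ cong c)
  degree-bound-at v lone-v j | no j≢cv | false | true
    with singleton-adjacent-to-nonfull chi c rb v (lone⇒Singleton v lone-v) j j≢cv
           (does⁻ (size j <? r) (∧⁻ʳ {does (2 ≤? size j)} (subst T (sym medium-j) tt)))
  ... | w , cw≡j , v~w =
    ≤-trans (2≤m+𝟙[m≡1] (neighboursIn v j) (count-pos _ w (∧⁺ v~w (does⁺ (c w ≟ j) cw≡j)))) (m≤m+n _ _)
    where
    2≤m+𝟙[m≡1] : ∀ m → 1 ≤ m → 2 ≤ m + 𝟙 (does (m ≟ℕ 1))
    2≤m+𝟙[m≡1] (suc zero) _ = ≤-refl
    2≤m+𝟙[m≡1] (suc (suc m)) _ = s≤s (s≤s z≤n)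

  degree-bound : (v : Fin n) → T (lone v) →
    count single + (count medium + count medium) ≤ (degree G v + count (soleIn v)) + 1
  degree-bound v lone-v = begin
    count single + (count medium + count medium)                       ≡⟨ cong (count single +_) medium+medium ⟨
    count single + sum (λ j → 𝟙 (medium j) + 𝟙 (medium j))            ≡⟨ ∑-distrib-+ (𝟙 ∘ single) _ ⟨
    sum (λ j → 𝟙 (single j) + (𝟙 (medium j) + 𝟙 (medium j)))         ≤⟨ sum-mono-≤ _ _ (degree-bound-at v lone-v) ⟩
    sum (λ j → (neighboursIn v j + 𝟙 (soleIn v j)) + 𝟙 (is (c v) j)) ≡⟨ ∑-distrib-+ _ (𝟙 ∘ is (c v)) ⟩
    sum (λ j → neighboursIn v j + 𝟙 (soleIn v j)) + count (is (c v))  ≡⟨ cong₂ _+_ neighbours+soles (count-is (c v)) ⟩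
    (degree G v + count (soleIn v)) + 1                                ∎
    where
    open ≤-Reasoning
    medium+medium : sum (λ j → 𝟙 (medium j) + 𝟙 (medium j)) ≡ count medium + count medium
    medium+medium = ∑-distrib-+ (𝟙 ∘ medium) (𝟙 ∘ medium)
    neighbours+soles : sum (λ j → neighboursIn v j + 𝟙 (soleIn v j)) ≡ degree G v + count (soleIn v)
    neighbours+soles = begin-equality
      sum (λ j → neighboursIn v j + 𝟙 (soleIn v j)) ≡⟨ ∑-distrib-+ (neighboursIn v) (𝟙 ∘ soleIn v) ⟩
      sum (neighboursIn v) + count (soleIn v)        ≡⟨ cong (_+ count (soleIn v)) (count-partition c (adj G v)) ⟨
      count (adj G v) + count (soleIn v)             ≡⟨ cong (_+ count (soleIn v)) (degree≡count G v) ⟨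
      degree G v + count (soleIn v)                  ∎

  meets-classes⇒count≤ : (b : Fin n → Bool) (q : Fin k → Bool) → (∀ j → T (single j) → ¬ T (q j)) →
    (∀ v → T (lone v) → T (b v)) → (∀ j → T (q j) → ∃ λ z → c z ≡ j × T (b z)) →
    count single + count q ≤ count b
  meets-classes⇒count≤ b q disjoint lone⊆b meets = begin
    count single + count q                        ≡⟨ ∑-distrib-+ (𝟙 ∘ single) (𝟙 ∘ q) ⟨
    sum (λ j → 𝟙 (single j) + 𝟙 (q j))            ≤⟨ sum-mono-≤ _ _ met ⟩
    sum (λ j → count (λ z → b z ∧ is j (c z)))    ≡⟨ count-partition c b ⟨
    count b                                       ∎
    where
    open ≤-Reasoning
    met : ∀ j → 𝟙 (single j) + 𝟙 (q j) ≤ count (λ z → b z ∧ is j (c z))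
    met j with single j in single-j | q j in q-j
    ... | true | true = contradiction (subst T (sym q-j) tt) (disjoint j (subst T (sym single-j) tt))
    ... | false | false = z≤n
    ... | true | false with lone-member j (subst T (sym single-j) tt)
    ...   | u , refl , lone-u = count-pos _ u (∧⁺ (lone⊆b u lone-u) (does⁺ (c u ≟ c u) refl))
    met j | false | true with meets j (subst T (sym q-j) tt)
    ...   | z , refl , b-z = count-pos _ z (∧⁺ b-z (does⁺ (c z ≟ c z) refl))

  Shared : Fin n → Fin k → Set
  Shared v j = ∃ λ y → T (lone y) × y ≢ v × T (soleIn y j)

  shared? : (v : Fin n) (j : Fin k) → Dec (Shared v j)
  shared? v j = any? λ y → T? (lone y) ×-dec ¬? (y ≟ v) ×-dec T? (soleIn y j)

  sharing-lone-clique-bound : ∀ {ω} → IsCliqueNumber G ω → (v : Fin n) → T (lone v) →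
    (∀ j → T (soleIn v j) → Shared v j) → count single + count (soleIn v) ≤ ω
  sharing-lone-clique-bound cl v lone-v shared =
    ≤-trans (meets-classes⇒count≤ b (soleIn v) disjoint (λ _ → ∨⁺ ∘ inj₁) meets) (clique-count≤ω G cl b clique)
    where
    b : Fin n → Bool
    b z = lone z ∨ (soleIn v (c z) ∧ adj G v z)
    disjoint : ∀ j → T (single j) → ¬ T (soleIn v j)
    disjoint j single-j = single⇒¬medium j single-j ∘ ∧⁻ˡ
    meets : ∀ j → T (soleIn v j) → ∃ λ z → c z ≡ j × T (b z)
    meets j sole with soleIn-witness v j sole
    ... | w , refl , v~w = w , refl , ∨⁺ (inj₂ (∧⁺ sole v~w))
    clique : ∀ u w → T (b u) → T (b w) → u ≢ w → Adj G u w
    clique u w b-u b-w u≢w with ∨⁻ b-u | ∨⁻ b-w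
    ... | inj₁ lone-u | inj₁ lone-w = lones-adjacent lone-u lone-w u≢w
    ... | inj₁ lone-u | inj₂ nbr-w = Adj-sym G (sole-neighbour-adjacent-lone lone-v (∧⁻ˡ nbr-w) (∧⁻ʳ nbr-w) lone-u)
    ... | inj₂ nbr-u | inj₁ lone-w = sole-neighbour-adjacent-lone lone-v (∧⁻ˡ nbr-u) (∧⁻ʳ nbr-u) lone-w
    ... | inj₂ nbr-u | inj₂ nbr-w with c u ≟ c w | shared (c u) (∧⁻ˡ nbr-u)
    ...   | yes cu≡cw | _ =
      contradiction (soleIn⇒SoleNeighbour (∧⁻ˡ nbr-w) (∧⁻ʳ nbr-w) u cu≡cw (∧⁻ʳ nbr-u)) u≢w
    ...   | no cu≢cw | y , lone-y , y≢v , sole-y = sole-neighbours-adjacent-lone lone-y lone-v y≢v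
            sole-y y~u (∧⁻ˡ nbr-w) (∧⁻ʳ nbr-w) cu≢cw
      where
      y~u : Adj G y u
      y~u = Adj-sym G (sole-neighbour-adjacent-lone lone-v (∧⁻ˡ nbr-u) (∧⁻ʳ nbr-u) lone-y)

  single≤lone : count single ≤ count lone
  single≤lone = begin
    count single                          ≡⟨ +-identityʳ _ ⟨
    count single + 0                      ≡⟨ cong (count single +_) (count-none {k} (λ _ → false) λ _ ()) ⟨
    count single + count {k} (λ _ → false) ≤⟨ meets-classes⇒count≤ lone _ (λ _ _ ()) (λ _ → id) (λ _ ()) ⟩
    count lone                            ∎
    where open ≤-Reasoning

  module Owning (owner : Fin n → Fin k)
                (owns : ∀ v → T (lone v) → T (soleIn v (owner v)) × ¬ Shared v (owner v)) where

    soleIn-owned : ∀ x → T (lone x) → ∀ {j} → owner x ≡ j → T (soleIn x j)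
    soleIn-owned x lone-x refl = proj₁ (owns x lone-x)

    owner-injective : ∀ x y → T (lone x) → T (lone y) → owner x ≡ owner y → x ≡ y
    owner-injective x y lone-x lone-y e with y ≟ x
    ... | yes y≡x = sym y≡x
    ... | no y≢x = contradiction (y , lone-y , y≢x , soleIn-owned y lone-y (sym e)) (proj₂ (owns x lone-x))

    owned? : (j : Fin k) → Dec (∃ λ x → T (lone x) × owner x ≡ j)
    owned? j = any? λ x → T? (lone x) ×-dec owner x ≟ j

    owned : Fin k → Bool
    owned = does ∘ owned?

    lone≤owned : count lone ≤ count owned
    lone≤owned = count-injection lone owned owner (λ x lone-x → does⁺ (owned? (owner x)) (x , lone-x , refl))
                                 owner-injective

    ownedNeighbour? : (z : Fin n) → Dec (∃ λ x → T (lone x) × owner x ≡ c z × Adj G x z)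
    ownedNeighbour? z = any? λ x → T? (lone x) ×-dec owner x ≟ c z ×-dec T? (adj G x z)

    ownedNeighbour : Fin n → Bool
    ownedNeighbour = does ∘ ownedNeighbour?

    clique : ∀ u w → T (lone u ∨ ownedNeighbour u) → T (lone w ∨ ownedNeighbour w) → u ≢ w → Adj G u w
    clique u w b-u b-w u≢w with ∨⁻ b-u | ∨⁻ b-w
    ... | inj₁ lone-u | inj₁ lone-w = lones-adjacent lone-u lone-w u≢w
    ... | inj₁ lone-u | inj₂ nbr-w with does⁻ (ownedNeighbour? w) nbr-w
    ...   | x , lone-x , ox≡cw , x~w =
      Adj-sym G (sole-neighbour-adjacent-lone lone-x (soleIn-owned x lone-x ox≡cw) x~w lone-u)
    clique u w b-u b-w u≢w | inj₂ nbr-u | inj₁ lone-w with does⁻ (ownedNeighbour? u) nbr-u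
    ...   | x , lone-x , ox≡cu , x~u = sole-neighbour-adjacent-lone lone-x (soleIn-owned x lone-x ox≡cu) x~u lone-w
    clique u w b-u b-w u≢w | inj₂ nbr-u | inj₂ nbr-w
      with does⁻ (ownedNeighbour? u) nbr-u | does⁻ (ownedNeighbour? w) nbr-w
    ... | x , lone-x , ox≡cu , x~u | y , lone-y , oy≡cw , y~w with x ≟ y
    ...   | yes refl =
      contradiction (soleIn⇒SoleNeighbour (soleIn-owned y lone-y oy≡cw) y~w u (trans (sym ox≡cu) oy≡cw) x~u) u≢w
    ...   | no x≢y = sole-neighbours-adjacent-lone lone-x lone-y x≢y
              (soleIn-owned x lone-x ox≡cu) x~u (soleIn-owned y lone-y oy≡cw) y~w
              λ cu≡cw → x≢y (owner-injective x y lone-x lone-y (trans ox≡cu (trans cu≡cw (sym oy≡cw))))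

    owners-clique-bound : ∀ {ω} → IsCliqueNumber G ω → 2 * count single ≤ ω
    owners-clique-bound {ω} cl = begin
      2 * count single            ≡⟨ cong (count single +_) (+-identityʳ _) ⟩
      count single + count single ≤⟨ +-monoʳ-≤ (count single) (≤-trans single≤lone lone≤owned) ⟩
      count single + count owned  ≤⟨ meets-classes⇒count≤ b owned disjoint (λ _ → ∨⁺ ∘ inj₁) meets ⟩
      count b                     ≤⟨ clique-count≤ω G cl b clique ⟩
      ω                           ∎
      where
      open ≤-Reasoning
      b : Fin n → Bool
      b z = lone z ∨ ownedNeighbour z
      disjoint : ∀ j → T (single j) → ¬ T (owned j)
      disjoint j single-j owned-j with does⁻ (owned? j) owned-j
      ... | x , lone-x , refl = single⇒¬medium (owner x) single-j (∧⁻ˡ (soleIn-owned x lone-x refl))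
      meets : ∀ j → T (owned j) → ∃ λ z → c z ≡ j × T (b z)
      meets j owned-j with does⁻ (owned? j) owned-j
      ... | x , lone-x , refl with soleIn-witness x (owner x) (soleIn-owned x lone-x refl)
      ...   | w , cw≡j , x~w = w , cw≡j , ∨⁺ (inj₂ (does⁺ (ownedNeighbour? w) (x , lone-x , sym cw≡j , x~w)))

  sharing-lone-exists : ∀ {ω} → IsCliqueNumber G ω → ω < 2 * count single →
    ∃ λ v → T (lone v) × (∀ j → T (soleIn v j) → Shared v j)
  sharing-lone-exists cl ω<2s
    with any? (λ v → T? (lone v) ×-dec all? (λ j → T? (soleIn v j) →-dec shared? v j))
  ... | yes found = found
  ... | no none = contradiction (Owning.owners-clique-bound owner owns cl) (<⇒≱ ω<2s)
    where
    owns-some : ∀ v → T (lone v) → ∃ λ j → T (soleIn v j) × ¬ Shared v j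
    owns-some v lone-v
      with ¬∀⟶∃¬ k _ (λ j → T? (soleIn v j) →-dec shared? v j) (λ all → none (v , lone-v , all))
    ... | j , ¬[sole⇒shared] with T? (soleIn v j)
    ...   | yes sole = j , sole , ¬[sole⇒shared] ∘ const
    ...   | no ¬sole = contradiction (λ sole → contradiction sole ¬sole) ¬[sole⇒shared]
    owner : Fin n → Fin k
    owner v with T? (lone v)
    ... | yes lone-v = proj₁ (owns-some v lone-v)
    ... | no _ = c v
    owns : ∀ v → T (lone v) → T (soleIn v (owner v)) × ¬ Shared v (owner v)
    owns v lone-v with T? (lone v)
    ... | yes lone-v′ = proj₂ (owns-some v lone-v′)
    ... | no ¬lone = contradiction lone-v ¬lone

  colours≤full+single+medium : k ≤ count full + (count single + count medium)
  colours≤full+single+medium = begin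
    k                                              ≡⟨ count-true k ⟨
    count {k} (λ _ → true)                         ≤⟨ count-cover _ full _ (λ j _ → kind j) ⟩
    count full + count (λ j → single j ∨ medium j) ≤⟨ +-monoʳ-≤ (count full) (count-cover _ single medium (λ _ → ∨⁻)) ⟩
    count full + (count single + count medium)     ∎
    where
    open ≤-Reasoning
    kind : ∀ j → T (full j) ⊎ T (single j ∨ medium j)
    kind j with size j ≟ℕ r | size j ≟ℕ 1
    ... | yes size≡r | _ = inj₁ (does⁺ (size j ≟ℕ r) size≡r)
    ... | no _ | yes size≡1 = inj₂ (∨⁺ (inj₁ (does⁺ (size j ≟ℕ 1) size≡1)))
    ... | no size≢r | no size≢1 = inj₂ (∨⁺ (inj₂ (∧⁺ (does⁺ (2 ≤? size j) 2≤size) (does⁺ (size j <? r) size<r))))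
      where
      2≤size : 2 ≤ size j
      2≤size = ≤∧≢⇒< (optimal-classSize≥1 chi c rb j) (size≢1 ∘ sym)
      size<r : size j < r
      size<r = ≤∧≢⇒< (proj₂ rb j) size≢r

  excess-bound : ∀ {ω} → IsCliqueNumber G ω → ω < 2 * count single →
    2 * (count single + count medium) ≤ ω + Δ G + 1
  excess-bound cl ω<2s with sharing-lone-exists cl ω<2s
  ... | v , lone-v , shared =
    excess-arithmetic (degree-bound v lone-v) (sharing-lone-clique-bound cl v lone-v shared) (degree≤Δ G v)

  colours∸full≤single+medium : k ∸ classesOfSize r c ≤ count single + count medium
  colours∸full≤single+medium = m≤n+o⇒m∸n≤o k (classesOfSize r c)
    (subst (λ f → k ≤ f + (count single + count medium)) (sym (classesOfSize≡count r c))
           colours≤full+single+medium)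

theorem6p7 : ∀ (n : ℕ) (G : Graph n) (r : ℕ) → 1 ≤ r →
  ∀ (χr Mr ιr ω : ℕ) →
  IsChiR r G χr → IsMR r G Mr → IsIotaR r G ιr → IsCliqueNumber G ω →
  ω < 2 * ιr →
  2 * (χr ∸ Mr) ≤ ω + Δ G + 1
theorem6p7 n G r _ χr Mr ιr ω (_ , χr-minimal) (_ , Mr-maximal) ((k , c , optimal , c-has-ιr) , _) cl ω<2ιr =
  ≤-trans (*-monoʳ-≤ 2 (∸-mono (χr-minimal k c (proj₂ optimal)) (Mr-maximal k c optimal))) (excess (2 ≤? r))
  where
  open Recolouring G r
  excess : Dec (2 ≤ r) → 2 * (k ∸ classesOfSize r c) ≤ ω + Δ G + 1
  excess (yes 2≤r) = ≤-trans (*-monoʳ-≤ 2 colours∸full≤single+medium)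
    (excess-bound cl (subst (λ t → ω < 2 * t) (trans (sym c-has-ιr) (classesOfSize≡count 1 c)) ω<2ιr))
    where open OptimalCounting G r 2≤r (proj₁ optimal) c (proj₂ optimal)
  excess (no r≱2) = subst (_≤ ω + Δ G + 1) (cong (2 *_) (sym (m≤n⇒m∸n≡0 k≤full))) z≤n
    where
    k≤full : k ≤ classesOfSize r c
    k≤full = r≤1⇒optimal-classes-full (≤-pred (≰⇒> r≱2)) (proj₁ optimal) c (proj₂ optimal)
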